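{- Let $\mathbf I=(i_0,i_1,\ldots,i_f,0,0,\ldots)$ be the frame of some Dyck path, where $i_f$ is the last nonzero entry. Define $j_1=i_0-2$, $j_2=i_1-i_0$, $j_3=i_2-i_1+i_0-2$, $j_4=i_3-i_2+i_1-i_0$, and in general, for $1\le k\le f$, $$j_k=\sum_{m=0}^{k-1}(-1)^{k-1-m}i_m-\begin{cases}2,& k \text{ odd}\\ 0,& k\text{ even}.\end{cases}$$ Then the number of Dyck paths with frame $\mathbf I$ is $$\binom{i_1-1}{i_1-j_1-1}\binom{i_2-1}{i_2-j_2-1}\cdots\binom{i_f-1}{i_f-j_f-1}.$$
   Context: A Dyck path of length $2n$ is a lattice path from $(0,0)$ to $(2n,0)$ with steps $(1,1)$, $(1,-1)$ never going below the $x$-axis. The frame of a Dyck path is the eventually zero sequence $(i_0,i_1,\ldots)$ where $i_k$ is the number of vertices (including endpoints) at height $k$. -}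

module Defs where

open import Data.Bool using (Bool; true; false; if_then_else_)
open import Data.Nat using (ℕ; zero; suc; _∸_; _≟_; _%_)
open import Data.Nat.Combinatorics using (_C_)
open import Data.Integer using (ℤ; +_; -[1+_]; -1ℤ; _^_; _*_; _+_; _-_)
open import Data.List using (List; []; _∷_; length; filter; foldr; map; applyUpTo; upTo)
open import Data.Nat.ListAction using (product)
open import Relation.Binary.PropositionalEquality using (_≡_)
open import Data.Maybe using (Maybe; just; nothing)

-- A step of a lattice path: up = (1,1), down = (1,-1).
data Step : Set where
  up down : Step

walk : ℕ → List Step → Maybe ℕ
walk h [] = just h
walk h (up ∷ w) = walk (suc h) w
walk zero (down ∷ w) = nothing
walk (suc h) (down ∷ w) = walk h w

IsDyck : List Step → Set
IsDyck w = walk 0 w ≡ just 0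

heights : ℕ → List Step → List ℕ
heights h [] = h ∷ []
heights h (up ∷ w) = h ∷ heights (suc h) w
heights h (down ∷ w) = h ∷ heights (h ∸ 1) w

frame : List Step → ℕ → ℕ
frame w k = length (filter (_≟ k) (heights 0 w))

altSum : (ℕ → ℕ) → ℕ → ℤ
altSum i k = foldr _+_ (+ 0) (map (λ m → (-1ℤ ^ (k ∸ 1 ∸ m)) * (+ i m)) (upTo k))

jSeq : (ℕ → ℕ) → ℕ → ℤ
jSeq i k = altSum i k - (if isOdd k then + 2 else + 0)
  where
  isOdd : ℕ → Bool
  isOdd n with n % 2
  ... | zero = false
  ... | suc _ = true

-- Binomial coefficient with integer lower index (zero for negative lower index).
binomℤ : ℕ → ℤ → ℕ
binomℤ n (+ k) = n C k
binomℤ n -[1+ _ ] = 0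

frameCount : (ℕ → ℕ) → ℕ → ℕ
frameCount i f =
  product (map (λ k → binomℤ (i k ∸ 1) ((+ i k - jSeq i k) - + 1)) (applyUpTo suc f))

-- A Dyck path is the concatenation of its arches  up · x · down,  where each
-- x is again a Dyck path; reading the arches as the subtrees of a root, a
-- list of Dyck paths is a plane forest.  A forest with a trees whose level
-- profile is (t₀, t₁, …) (t_k = vertices at height k, summed over the trees)
-- is the same thing as a forest with t₀ − a trees and profile (t₁, t₂, …),
-- namely the concatenation of all the subtrees of all roots, together with a
-- way of cutting that list into a consecutive blocks (the subtrees of each
-- root).  There are C(t₀ − 1, t₀ − a) such cuttings.  Iterating, the Dyck
-- paths with frame i are enumerated by an explicit duplicate-free list, of
-- length ∏_k C(i_k − 1, i_k − a_k) with a₀ = 1 and a_{k+1} = i_k − a_k.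
-- Finally j_k = a_k − 1, because the alternating sums satisfy
-- j_{k+1} = i_k − j_k − 2, so these factors are those of the theorem.

module Submission where

open import Defs
open import Data.Bool using (if_then_else_; true; false)
open import Data.Nat using (ℕ; zero; suc; _∸_; _≤_; _<_; z≤n; s≤s; _≡ᵇ_; _≟_; _≤?_; _%_)
open import Data.Nat.Properties
  using (≤-trans; ≤-reflexive; m≤m+n; m≤n+m; n≤1+n; +-assoc; +-comm; +-suc; +-identityʳ;
         *-comm; *-identityˡ; m+n∸m≡n; m∸n+n≡m; m+[n∸m]≡n; +-∸-assoc; n∸n≡0)
open import Data.Nat.Combinatorics using (_C_; nCn≡1; k>n⇒nCk≡0; nCk+nC[k+1]≡[n+1]C[k+1])
open import Data.Nat.ListAction using (product)
open import Data.List
  using (List; []; _∷_; _++_; [_]; length; filter; map; concat; concatMap; foldr; upTo; applyUpTo)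
open import Data.List.Properties
  using (length-++; length-map; ∷-injectiveˡ; ∷-injectiveʳ; ++-identityʳ; upTo-∷ʳ)
open import Data.Empty using (⊥; ⊥-elim)
open import Data.List.Membership.Propositional using (_∈_; find; lose)
open import Data.List.Membership.Propositional.Properties
  using (∈-map⁺; ∈-map⁻; ∈-++⁺ˡ; ∈-++⁺ʳ; ∈-concatMap⁺; ∈-concatMap⁻)
open import Data.List.Relation.Unary.Any using (here; there)
open import Data.List.Relation.Unary.All as All using (All; []; _∷_)
import Data.List.Relation.Unary.All.Properties as All
import Data.List.Relation.Unary.AllPairs as AllPairs
open import Data.List.Relation.Unary.Unique.Propositional using (Unique)
import Data.List.Relation.Unary.Unique.Propositional.Properties as Unique
open import Data.Maybe using (just)
open import Data.Product using (Σ; _×_; _,_; proj₁; proj₂; map₂; ∃-syntax)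
open import Data.Sum using (_⊎_; inj₁; inj₂)
open import Relation.Binary.PropositionalEquality
  using (_≡_; _≢_; refl; sym; trans; cong; cong₂; subst; module ≡-Reasoning)
open import Relation.Nullary using (yes; no)
open import Function.Bundles using (_⇔_; mk⇔)

-- The alternating sums j_k of the theorem satisfy j_{k+1} = i_k − j_k − 2;
-- hence if j_k = a − 1 with a ≤ i_k then j_{k+1} = (i_k − a) − 1, and the
-- k-th factor of frameCount is C(i_k − 1, i_k − a).
module AlternatingSums (i : ℕ → ℕ) where
  open import Data.Integer using (ℤ; +_; -_; _+_; _-_; _*_; -1ℤ; _^_)
  import Data.Integer.Properties as ℤ
  open import Data.Integer.Tactic.RingSolver using (solve-∀)

  -- The term (−1)^(e − m) i_m; altSum i k sums signed (k − 1) m over m < k.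
  signed : ℕ → ℕ → ℤ
  signed e m = (-1ℤ ^ (e ∸ m)) * + i m

  sumℤ : List ℤ → ℤ
  sumℤ = foldr _+_ (+ 0)

  sumℤ-snoc : ∀ (f : ℕ → ℤ) xs x → sumℤ (map f (xs ++ [ x ])) ≡ sumℤ (map f xs) + f x
  sumℤ-snoc f [] x = trans (ℤ.+-identityʳ (f x)) (sym (ℤ.+-identityˡ (f x)))
  sumℤ-snoc f (y ∷ xs) x = trans (cong (_+_ (f y)) (sumℤ-snoc f xs x)) (sym (ℤ.+-assoc (f y) _ _))

  sumℤ-neg : ∀ {f g : ℕ → ℤ} {xs} → All (λ m → f m ≡ - g m) xs →
    sumℤ (map f xs) ≡ - sumℤ (map g xs)
  sumℤ-neg [] = refl
  sumℤ-neg {g = g} {x ∷ xs} (e ∷ es) =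
    trans (cong₂ _+_ e (sumℤ-neg es)) (sym (ℤ.neg-distrib-+ (g x) (sumℤ (map g xs))))

  signed-flip : ∀ k m → m < k → signed k m ≡ - signed (k ∸ 1) m
  signed-flip (suc k) m (s≤s m≤k) rewrite +-∸-assoc 1 m≤k =
    trans (ℤ.*-assoc -1ℤ (-1ℤ ^ (k ∸ m)) (+ i m)) (ℤ.-1*i≡-i (signed k m))

  altSum-step : ∀ k → altSum i (suc k) ≡ + i k - altSum i k
  altSum-step k = begin
    sumℤ (map (signed k) (upTo (suc k)))
      ≡⟨ cong (λ ms → sumℤ (map (signed k) ms)) (sym (upTo-∷ʳ k)) ⟩
    sumℤ (map (signed k) (upTo k ++ [ k ]))
      ≡⟨ sumℤ-snoc (signed k) (upTo k) k ⟩
    sumℤ (map (signed k) (upTo k)) + signed k k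
      ≡⟨ cong₂ _+_ (sumℤ-neg (All.applyUpTo⁺₁ (λ m → m) k (signed-flip k _))) (diagonal k) ⟩
    - altSum i k + + i k
      ≡⟨ ℤ.+-comm (- altSum i k) (+ i k) ⟩
    + i k - altSum i k ∎
    where
    open ≡-Reasoning
    diagonal : ∀ k → signed k k ≡ + i k
    diagonal k rewrite n∸n≡0 k = ℤ.*-identityˡ (+ i k)

  offset : ℕ → ℤ
  offset zero = + 0
  offset (suc zero) = + 2
  offset (suc (suc k)) = offset k

  -- offset k is the correction subtracted in jSeq, which tests k % 2.
  offset-parity : ∀ k → (k % 2 ≡ 0 × offset k ≡ + 0) ⊎ (k % 2 ≡ 1 × offset k ≡ + 2)
  offset-parity zero = inj₁ (refl , refl)
  offset-parity (suc zero) = inj₂ (refl , refl)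
  offset-parity (suc (suc k)) = offset-parity k

  offset-step : ∀ k → offset (suc k) ≡ + 2 - offset k
  offset-step zero = refl
  offset-step (suc zero) = refl
  offset-step (suc (suc k)) = offset-step k

  jSeq-offset : ∀ k → jSeq i k ≡ altSum i k - offset k
  jSeq-offset k with offset-parity k
  ... | inj₁ (parity , o) rewrite parity | o = refl
  ... | inj₂ (parity , o) rewrite parity | o = refl

  jSeq-step : ∀ k → jSeq i (suc k) ≡ (+ i k - jSeq i k) - + 2
  jSeq-step k = begin
    jSeq i (suc k)                          ≡⟨ jSeq-offset (suc k) ⟩
    altSum i (suc k) - offset (suc k)       ≡⟨ cong₂ _-_ (altSum-step k) (offset-step k) ⟩
    (+ i k - altSum i k) - (+ 2 - offset k) ≡⟨ regroup (+ i k) (altSum i k) (offset k) ⟩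
    (+ i k - (altSum i k - offset k)) - + 2 ≡⟨ cong (λ j → (+ i k - j) - + 2) (sym (jSeq-offset k)) ⟩
    (+ i k - jSeq i k) - + 2 ∎
    where
    open ≡-Reasoning
    regroup : ∀ x s o → (x - s) - (+ 2 - o) ≡ (x - (s - o)) - + 2
    regroup = solve-∀

  -- Roots k a: j_k = a − 1, i.e. a trees are rooted at level k.
  Roots : ℕ → ℕ → Set
  Roots k a = jSeq i k ≡ + a - + 1

  roots-zero : Roots 0 1
  roots-zero = refl

  minus-ℕ : ∀ {m n} → n ≤ m → + m - + n ≡ + (m ∸ n)
  minus-ℕ {m} {n} n≤m = trans (ℤ.m-n≡m⊖n m n) (ℤ.⊖-≥ n≤m)

  jSeq-roots-step : ∀ k a → Roots k a → a ≤ i k → Roots (suc k) (i k ∸ a)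
  jSeq-roots-step k a jk a≤ik = begin
    jSeq i (suc k)                ≡⟨ jSeq-step k ⟩
    (+ i k - jSeq i k) - + 2      ≡⟨ cong (λ j → (+ i k - j) - + 2) jk ⟩
    (+ i k - (+ a - + 1)) - + 2   ≡⟨ regroup (+ i k) (+ a) ⟩
    (+ i k - + a) - + 1           ≡⟨ cong (_- + 1) (minus-ℕ a≤ik) ⟩
    + (i k ∸ a) - + 1 ∎
    where
    open ≡-Reasoning
    regroup : ∀ x y → (x - (y - + 1)) - + 2 ≡ (x - y) - + 1
    regroup = solve-∀

  frameFactor : ℕ → ℕ
  frameFactor k = binomℤ (i k ∸ 1) ((+ i k - jSeq i k) - + 1)

  frameFactor-roots : ∀ k a → Roots k a → a ≤ i k → frameFactor k ≡ (i k ∸ 1) C (i k ∸ a)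
  frameFactor-roots k a jk a≤ik =
    cong (binomℤ (i k ∸ 1)) (trans (cong (λ j → (+ i k - j) - + 1) jk)
                                   (trans (regroup (+ i k) (+ a)) (minus-ℕ a≤ik)))
    where
    regroup : ∀ x y → (x - (y - + 1)) - + 1 ≡ x - y
    regroup = solve-∀

open import Data.Nat using (_+_; _*_)

walk-++ : ∀ h x y {h'} → walk h x ≡ just h' → walk h (x ++ y) ≡ walk h' y
walk-++ h [] y refl = refl
walk-++ h (up ∷ x) y p = walk-++ (suc h) x y p
walk-++ (suc h) (down ∷ x) y p = walk-++ h x y p

walk-lift : ∀ h x {h'} → walk h x ≡ just h' → walk (suc h) x ≡ just (suc h')
walk-lift h [] refl = refl
walk-lift h (up ∷ x) p = walk-lift (suc h) x p
walk-lift (suc h) (down ∷ x) p = walk-lift h x p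

arches : List (List Step) → List Step
arches [] = []
arches (x ∷ xs) = up ∷ x ++ down ∷ arches xs

walk-arch : ∀ x r → IsDyck x → walk 0 (up ∷ x ++ down ∷ r) ≡ walk 0 r
walk-arch x r dx = walk-++ 1 x (down ∷ r) (walk-lift 0 x dx)

arches-dyck : ∀ {xs} → All IsDyck xs → IsDyck (arches xs)
arches-dyck [] = refl
arches-dyck {x ∷ xs} (dx ∷ dxs) = trans (walk-arch x (arches xs) dx) (arches-dyck dxs)

-- firstReturn d w cuts w at its first step from relative height 0 to −1,
-- where w starts at relative height d.
firstReturn : ℕ → List Step → List Step × List Step
firstReturn d [] = [] , []
firstReturn d (up ∷ w) = let (x , y) = firstReturn (suc d) w in up ∷ x , y
firstReturn zero (down ∷ w) = [] , w
firstReturn (suc d) (down ∷ w) = let (x , y) = firstReturn d w in down ∷ x , y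

firstReturn-arch : ∀ d x y → walk d x ≡ just 0 → firstReturn d (x ++ down ∷ y) ≡ (x , y)
firstReturn-arch d [] y refl = refl
firstReturn-arch d (up ∷ x) y p rewrite firstReturn-arch (suc d) x y p = refl
firstReturn-arch (suc d) (down ∷ x) y p rewrite firstReturn-arch d x y p = refl

firstReturn-split : ∀ d w → walk (suc d) w ≡ just 0 →
  let (x , y) = firstReturn d w in
  w ≡ x ++ down ∷ y × walk d x ≡ just 0 × IsDyck y
firstReturn-split d (up ∷ w) p =
  let (e , dx , dy) = firstReturn-split (suc d) w p in cong (up ∷_) e , dx , dy
firstReturn-split zero (down ∷ w) p = refl , refl , p
firstReturn-split (suc d) (down ∷ w) p =
  let (e , dx , dy) = firstReturn-split d w p in cong (down ∷_) e , dx , dy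

arches-injective : ∀ {xs ys} → All IsDyck xs → All IsDyck ys → arches xs ≡ arches ys → xs ≡ ys
arches-injective [] [] _ = refl
arches-injective {x ∷ xs} {y ∷ ys} (dx ∷ dxs) (dy ∷ dys) e =
  cong₂ _∷_ (cong proj₁ cut) (arches-injective dxs dys (cong proj₂ cut))
  where
  cut : (x , arches xs) ≡ (y , arches ys)
  cut = trans (sym (firstReturn-arch 0 x (arches xs) dx))
          (trans (cong (firstReturn 0) (∷-injectiveʳ e)) (firstReturn-arch 0 y (arches ys) dy))

map-arches-injective : ∀ {ls ms} → All (All IsDyck) ls → All (All IsDyck) ms →
  map arches ls ≡ map arches ms → ls ≡ ms
map-arches-injective [] [] _ = refl
map-arches-injective (dl ∷ dls) (dm ∷ dms) e =
  cong₂ _∷_ (arches-injective dl dm (∷-injectiveˡ e)) (map-arches-injective dls dms (∷-injectiveʳ e))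

arch-decomposition : ∀ w → IsDyck w → ∃[ xs ] (All IsDyck xs × w ≡ arches xs)
arch-decomposition w = decompose (length w) w (≤-reflexive refl)
  where
  decompose : ∀ n w → length w ≤ n → IsDyck w → ∃[ xs ] (All IsDyck xs × w ≡ arches xs)
  decompose n [] _ _ = [] , [] , refl
  decompose (suc n) (up ∷ w) (s≤s bound) p
    with firstReturn 0 w | firstReturn-split 0 w p
  ... | x , y | refl , dx , dy =
    let shorter : length y ≤ n
        shorter = ≤-trans (≤-trans (n≤1+n (length y)) (m≤n+m (suc (length y)) (length x)))
                    (≤-trans (≤-reflexive (sym (length-++ x))) bound)
        (ys , dys , e) = decompose n y shorter dy
    in x ∷ ys , dx ∷ dys , cong (λ r → up ∷ x ++ down ∷ r) e

hit : ℕ → ℕ → ℕ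
hit h k = if h ≡ᵇ k then 1 else 0

visits : ℕ → List Step → ℕ → ℕ
visits h [] k = 0
visits h (up ∷ w) k = hit (suc h) k + visits (suc h) w k
visits h (down ∷ w) k = hit (h ∸ 1) k + visits (h ∸ 1) w k

count-cons : ∀ h k xs → length (filter (_≟ k) (h ∷ xs)) ≡ hit h k + length (filter (_≟ k) xs)
count-cons h k xs with h ≡ᵇ k
... | true = refl
... | false = refl

count-heights : ∀ h w k → length (filter (_≟ k) (heights h w)) ≡ hit h k + visits h w k
count-heights h [] k = count-cons h k []
count-heights h (up ∷ w) k =
  trans (count-cons h k _) (cong (hit h k +_) (count-heights (suc h) w k))
count-heights h (down ∷ w) k =
  trans (count-cons h k _) (cong (hit h k +_) (count-heights (h ∸ 1) w k))

frame-visits : ∀ w k → frame w k ≡ hit 0 k + visits 0 w k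
frame-visits = count-heights 0

visits-++ : ∀ h x y {h'} k → walk h x ≡ just h' → visits h (x ++ y) k ≡ visits h x k + visits h' y k
visits-++ h [] y k refl = refl
visits-++ h (up ∷ x) y k p =
  trans (cong (hit (suc h) k +_) (visits-++ (suc h) x y k p)) (sym (+-assoc (hit (suc h) k) _ _))
visits-++ (suc h) (down ∷ x) y k p =
  trans (cong (hit h k +_) (visits-++ h x y k p)) (sym (+-assoc (hit h k) _ _))

visits-lift : ∀ h x {h'} k → walk h x ≡ just h' → visits (suc h) x (suc k) ≡ visits h x k
visits-lift h [] k p = refl
visits-lift h (up ∷ x) k p = cong (hit (suc h) k +_) (visits-lift (suc h) x k p)
visits-lift (suc h) (down ∷ x) k p = cong (hit h k +_) (visits-lift h x k p)

visits-lift-ground : ∀ h x {h'} → walk h x ≡ just h' → visits (suc h) x 0 ≡ 0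
visits-lift-ground h [] p = refl
visits-lift-ground h (up ∷ x) p = visits-lift-ground (suc h) x p
visits-lift-ground (suc h) (down ∷ x) p = visits-lift-ground h x p

visits-arch : ∀ x r k → IsDyck x →
  visits 0 (up ∷ x ++ down ∷ r) k ≡ hit 1 k + (visits 1 x k + (hit 0 k + visits 0 r k))
visits-arch x r k dx = cong (hit 1 k +_) (visits-++ 1 x (down ∷ r) k (walk-lift 0 x dx))

forestFrame : List (List Step) → ℕ → ℕ
forestFrame [] k = 0
forestFrame (F ∷ Fs) k = frame F k + forestFrame Fs k

forestFrame-++ : ∀ xs ys k → forestFrame (xs ++ ys) k ≡ forestFrame xs k + forestFrame ys k
forestFrame-++ [] ys k = refl
forestFrame-++ (x ∷ xs) ys k =
  trans (cong (frame x k +_) (forestFrame-++ xs ys k)) (sym (+-assoc (frame x k) _ _))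

frame-arches-ground : ∀ {xs} → All IsDyck xs → frame (arches xs) 0 ≡ suc (length xs)
frame-arches-ground [] = refl
frame-arches-ground {x ∷ xs} (dx ∷ dxs) = begin
  frame (arches (x ∷ xs)) 0
    ≡⟨ frame-visits (arches (x ∷ xs)) 0 ⟩
  suc (visits 0 (up ∷ x ++ down ∷ arches xs) 0)
    ≡⟨ cong suc (visits-arch x (arches xs) 0 dx) ⟩
  suc (visits 1 x 0 + suc (visits 0 (arches xs) 0))
    ≡⟨ cong (λ v → suc (v + _)) (visits-lift-ground 0 x dx) ⟩
  suc (suc (visits 0 (arches xs) 0))
    ≡⟨ cong suc (sym (frame-visits (arches xs) 0)) ⟩
  suc (frame (arches xs) 0)
    ≡⟨ cong suc (frame-arches-ground dxs) ⟩
  suc (suc (length xs)) ∎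
  where open ≡-Reasoning

frame-arches-above : ∀ {xs} → All IsDyck xs → ∀ k → frame (arches xs) (suc k) ≡ forestFrame xs k
frame-arches-above [] k = refl
frame-arches-above {x ∷ xs} (dx ∷ dxs) k = begin
  frame (arches (x ∷ xs)) (suc k)
    ≡⟨ frame-visits (arches (x ∷ xs)) (suc k) ⟩
  visits 0 (up ∷ x ++ down ∷ arches xs) (suc k)
    ≡⟨ visits-arch x (arches xs) (suc k) dx ⟩
  hit 0 k + (visits 1 x (suc k) + visits 0 (arches xs) (suc k))
    ≡⟨ cong (λ v → hit 0 k + (v + _)) (visits-lift 0 x k dx) ⟩
  hit 0 k + (visits 0 x k + visits 0 (arches xs) (suc k))
    ≡⟨ sym (+-assoc (hit 0 k) _ _) ⟩
  (hit 0 k + visits 0 x k) + visits 0 (arches xs) (suc k)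
    ≡⟨ cong₂ _+_ (sym (frame-visits x k)) (sym (frame-visits (arches xs) (suc k))) ⟩
  frame x k + frame (arches xs) (suc k)
    ≡⟨ cong (frame x k +_) (frame-arches-above dxs k) ⟩
  frame x k + forestFrame xs k ∎
  where open ≡-Reasoning

forestFrame-arches-ground : ∀ {ls} → All (All IsDyck) ls →
  forestFrame (map arches ls) 0 ≡ length ls + length (concat ls)
forestFrame-arches-ground [] = refl
forestFrame-arches-ground {l ∷ ls} (dl ∷ dls) = begin
  frame (arches l) 0 + forestFrame (map arches ls) 0
    ≡⟨ cong₂ _+_ (frame-arches-ground dl) (forestFrame-arches-ground dls) ⟩
  suc (length l + (length ls + length (concat ls)))
    ≡⟨ cong suc (swap (length l) (length ls) _) ⟩
  suc (length ls + (length l + length (concat ls)))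
    ≡⟨ cong (λ n → suc (length ls + n)) (sym (length-++ l)) ⟩
  suc (length ls + length (l ++ concat ls)) ∎
  where
  open ≡-Reasoning
  swap : ∀ a b c → a + (b + c) ≡ b + (a + c)
  swap a b c = trans (sym (+-assoc a b c)) (trans (cong (_+ c) (+-comm a b)) (+-assoc b a c))

forestFrame-arches-above : ∀ {ls} → All (All IsDyck) ls → ∀ k →
  forestFrame (map arches ls) (suc k) ≡ forestFrame (concat ls) k
forestFrame-arches-above [] k = refl
forestFrame-arches-above {l ∷ ls} (dl ∷ dls) k =
  trans (cong₂ _+_ (frame-arches-above dl k) (forestFrame-arches-above dls k))
        (sym (forestFrame-++ l (concat ls) k))

-- Put x in front of the first block (injective, and never a list starting with []).
attach : ∀ {A : Set} → A → List (List A) → List (List A)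
attach x [] = []
attach x (b ∷ bs) = (x ∷ b) ∷ bs

-- groupings a R: all lists of a (possibly empty) blocks whose concatenation is R.
-- Either the first block is empty, or it contains the head x of R.
groupings : ∀ {A : Set} → ℕ → List A → List (List (List A))
groupings zero [] = [ [] ]
groupings zero (x ∷ R) = []
groupings (suc a) [] = map ([] ∷_) (groupings a [])
groupings (suc a) (x ∷ R) = map ([] ∷_) (groupings a (x ∷ R)) ++ map (attach x) (groupings (suc a) R)

Blocks : ∀ {A : Set} → ℕ → List A → List (List A) → Set
Blocks a R bs = concat bs ≡ R × length bs ≡ a

groupings-sound : ∀ {A : Set} a (R : List A) → All (Blocks a R) (groupings a R)
groupings-sound zero [] = (refl , refl) ∷ []
groupings-sound zero (x ∷ R) = []
groupings-sound (suc a) [] = All.map⁺ {f = [] ∷_} (All.map (map₂ (cong suc)) (groupings-sound a []))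
groupings-sound (suc a) (x ∷ R) =
  All.++⁺ (All.map⁺ {f = [] ∷_} (All.map (map₂ (cong suc)) (groupings-sound a (x ∷ R))))
          (All.map⁺ {f = attach x} (All.map (λ {bs} → attach-blocks {bs}) (groupings-sound (suc a) R)))
  where
  attach-blocks : ∀ {bs} → Blocks (suc a) R bs → Blocks (suc a) (x ∷ R) (attach x bs)
  attach-blocks {b ∷ bs} (c , l) = cong (x ∷_) c , l

groupings-complete : ∀ {A : Set} (bs : List (List A)) → bs ∈ groupings (length bs) (concat bs)
groupings-complete [] = here refl
groupings-complete ([] ∷ bs) with concat bs | groupings-complete bs
... | [] | p = ∈-map⁺ ([] ∷_) p
... | x ∷ R | p = ∈-++⁺ˡ (∈-map⁺ ([] ∷_) p)
groupings-complete ((x ∷ b) ∷ bs) =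
  ∈-++⁺ʳ (map ([] ∷_) (groupings (length bs) (x ∷ b ++ concat bs)))
         (∈-map⁺ (attach x) (groupings-complete (b ∷ bs)))

-- No cutting is listed twice: the two halves of the recursion differ in
-- whether the first block is empty.
groupings-unique : ∀ {A : Set} a (R : List A) → Unique (groupings a R)
groupings-unique zero [] = [] AllPairs.∷ AllPairs.[]
groupings-unique zero (x ∷ R) = AllPairs.[]
groupings-unique (suc a) [] = Unique.map⁺ ∷-injectiveʳ (groupings-unique a [])
groupings-unique (suc a) (x ∷ R) =
  Unique.++⁺ (Unique.map⁺ ∷-injectiveʳ (groupings-unique a (x ∷ R)))
             (Unique.map⁺ attach-injective (groupings-unique (suc a) R))
             (λ (p , q) → separate p q)
  where
  attach-injective : ∀ {bs cs} → attach x bs ≡ attach x cs → bs ≡ cs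
  attach-injective {[]} {[]} _ = refl
  attach-injective {_ ∷ _} {_ ∷ _} refl = refl
  separate : ∀ {cs} → cs ∈ map ([] ∷_) (groupings a (x ∷ R)) →
    cs ∈ map (attach x) (groupings (suc a) R) → ⊥
  separate p q with ∈-map⁻ ([] ∷_) p | ∈-map⁻ (attach x) q
  ... | _ , _ , refl | [] , _ , ()
  ... | _ , _ , refl | _ ∷ _ , _ , ()

groupings-length : ∀ {A : Set} a (R : List A) → length (groupings a R) ≡ (length R + a ∸ 1) C length R
groupings-length zero [] = refl
groupings-length zero (x ∷ R) = sym (k>n⇒nCk≡0 (≤-reflexive (cong suc (+-identityʳ (length R)))))
groupings-length (suc a) [] =
  trans (length-map ([] ∷_) (groupings a [])) (trans (groupings-length a []) (C-zero a))
  where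
  C-zero : ∀ a → (a ∸ 1) C 0 ≡ a C 0
  C-zero zero = refl
  C-zero (suc a) = refl
groupings-length (suc a) (x ∷ R) = begin
  length (map ([] ∷_) (groupings a (x ∷ R)) ++ map (attach x) (groupings (suc a) R))
    ≡⟨ length-++ (map ([] ∷_) (groupings a (x ∷ R))) ⟩
  length (map ([] ∷_) (groupings a (x ∷ R))) + length (map (attach x) (groupings (suc a) R))
    ≡⟨ cong₂ _+_ (length-map ([] ∷_) (groupings a (x ∷ R)))
                 (length-map (attach x) (groupings (suc a) R)) ⟩
  length (groupings a (x ∷ R)) + length (groupings (suc a) R)
    ≡⟨ cong₂ _+_ (groupings-length a (x ∷ R)) (groupings-length (suc a) R) ⟩
  (n + a) C suc n + (n + suc a ∸ 1) C n
    ≡⟨ cong (λ m → (n + a) C suc n + (m ∸ 1) C n) (+-suc n a) ⟩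
  (n + a) C suc n + (n + a) C n
    ≡⟨ +-comm ((n + a) C suc n) _ ⟩
  (n + a) C n + (n + a) C suc n
    ≡⟨ nCk+nC[k+1]≡[n+1]C[k+1] (n + a) n ⟩
  suc (n + a) C suc n
    ≡⟨ cong (λ m → m C suc n) (sym (+-suc n a)) ⟩
  (n + suc a) C suc n ∎
  where
  open ≡-Reasoning
  n : ℕ
  n = length R

unique-map : ∀ {A B : Set} (f : A → B) {xs} →
  (∀ {x y} → x ∈ xs → y ∈ xs → f x ≡ f y → x ≡ y) → Unique xs → Unique (map f xs)
unique-map f inj AllPairs.[] = AllPairs.[]
unique-map f inj (distinct AllPairs.∷ rest) =
  All.map⁺ (All.tabulate λ y∈ e → All.lookup distinct y∈ (inj (here refl) (there y∈) e))
  AllPairs.∷ unique-map f (λ p q → inj (there p) (there q)) rest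

∈-concatMap-find : ∀ {A B : Set} (h : A → List B) {xs z} →
  z ∈ concatMap h xs → ∃[ x ] (x ∈ xs × z ∈ h x)
∈-concatMap-find h {xs} p = find (∈-concatMap⁻ h {xs = xs} p)

unique-concatMap : ∀ {A B : Set} (h : A → List B) (decode : B → A) {xs} →
  (∀ x {z} → z ∈ h x → decode z ≡ x) → (∀ x → Unique (h x)) →
  Unique xs → Unique (concatMap h xs)
unique-concatMap h decode decodes uh AllPairs.[] = AllPairs.[]
unique-concatMap h decode {x ∷ xs} decodes uh (distinct AllPairs.∷ rest) =
  Unique.++⁺ (uh x) (unique-concatMap h decode decodes uh rest) separate
  where
  separate : ∀ {z} → z ∈ h x × z ∈ concatMap h xs → ⊥
  separate (p , q) with ∈-concatMap-find h q
  ... | y , y∈ , r = All.lookup distinct y∈ (trans (sym (decodes x p)) (decodes y r))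

length-concatMap : ∀ {A B : Set} (h : A → List B) n {xs} →
  All (λ x → length (h x) ≡ n) xs → length (concatMap h xs) ≡ length xs * n
length-concatMap h n [] = refl
length-concatMap h n {x ∷ xs} (e ∷ es) =
  trans (length-++ (h x)) (cong₂ _+_ e (length-concatMap h n es))

Forest : Set
Forest = List (List Step)

-- entry t k: the k-th entry of t, and 0 beyond its end.
entry : List ℕ → ℕ → ℕ
entry [] k = 0
entry (t ∷ ts) zero = t
entry (t ∷ ts) (suc k) = entry ts k

Shaped : ℕ → List ℕ → Forest → Set
Shaped a t Fs = All IsDyck Fs × length Fs ≡ a × (∀ k → forestFrame Fs k ≡ entry t k)

forest-arches : ∀ {Fs} → All IsDyck Fs → ∃[ ls ] (All (All IsDyck) ls × Fs ≡ map arches ls)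
forest-arches [] = [] , [] , refl
forest-arches {F ∷ Fs} (dF ∷ dFs) =
  let (xs , dxs , e) = arch-decomposition F dF ; (ls , dls , es) = forest-arches dFs
  in xs ∷ ls , dxs ∷ dls , cong₂ _∷_ e es

shaped-[] : ∀ {a Fs} → Shaped a [] Fs → a ≡ 0 × Fs ≡ []
shaped-[] {Fs = []} (_ , l , _) = sym l , refl
shaped-[] {Fs = F ∷ Fs} (_ , _ , e) with frame F 0 | frame-visits F 0 | e 0
... | _ | refl | ()

shaped-∷ : ∀ {a t ts Fs} → Shaped a (t ∷ ts) Fs →
  a ≤ t × ∃[ ls ] (Fs ≡ map arches ls × length ls ≡ a × Shaped (t ∸ a) ts (concat ls))
shaped-∷ {a} {t} {ts} (dFs , lFs , eFs) with forest-arches dFs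
... | ls , dls , refl =
  ≤-trans (m≤m+n a _) (≤-reflexive ground) , ls , refl , trees ,
  All.concat⁺ dls , inner , λ k → trans (sym (forestFrame-arches-above dls k)) (eFs (suc k))
  where
  trees : length ls ≡ a
  trees = trans (sym (length-map arches ls)) lFs
  ground : a + length (concat ls) ≡ t
  ground = trans (cong (_+ _) (sym trees)) (trans (sym (forestFrame-arches-ground dls)) (eFs 0))
  inner : length (concat ls) ≡ t ∸ a
  inner = trans (sym (m+n∸m≡n a _)) (cong (_∸ a) ground)

arches-shaped : ∀ {t ts ls} → length ls ≤ t → Shaped (t ∸ length ls) ts (concat ls) →
  Shaped (length ls) (t ∷ ts) (map arches ls)
arches-shaped {t} {ts} {ls} le (dR , lR , eR) =
  All.map⁺ (All.map arches-dyck dls) , length-map arches ls , profile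
  where
  dls : All (All IsDyck) ls
  dls = All.concat⁻ dR
  profile : ∀ k → forestFrame (map arches ls) k ≡ entry (t ∷ ts) k
  profile zero = trans (forestFrame-arches-ground dls) (trans (cong (length ls +_) lR) (m+[n∸m]≡n le))
  profile (suc k) = trans (forestFrame-arches-above dls k) (eR k)

forests : ℕ → List ℕ → List Forest
forests a (t ∷ ts) with a ≤? t
... | yes _ = map (map arches) (concatMap (groupings a) (forests (t ∸ a) ts))
... | no _ = []
forests zero [] = [ [] ]
forests (suc a) [] = []

forests-sound : ∀ a t {Fs} → Fs ∈ forests a t → Shaped a t Fs
forests-sound zero [] (here refl) = [] , refl , λ k → refl
forests-sound a (t ∷ ts) p with a ≤? t
forests-sound a (t ∷ ts) () | no _
... | yes le with ∈-map⁻ (map arches) p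
...   | ls , q , refl with ∈-concatMap-find (groupings a) {forests (t ∸ a) ts} q
...     | R , R∈ , ls∈ with All.lookup (groupings-sound a R) ls∈
...       | refl , refl = arches-shaped le (forests-sound (t ∸ length ls) ts R∈)

forests-complete : ∀ a t {Fs} → Shaped a t Fs → Fs ∈ forests a t
forests-complete a [] sh with shaped-[] sh
... | refl , refl = here refl
forests-complete a (t ∷ ts) sh with shaped-∷ sh
... | le , ls , refl , refl , inner with length ls ≤? t
...   | no ¬le = ⊥-elim (¬le le)
...   | yes _ = ∈-map⁺ (map arches)
                  (∈-concatMap⁺ (groupings (length ls))
                    (lose (forests-complete (t ∸ length ls) ts inner) (groupings-complete ls)))

forests-unique : ∀ a t → Unique (forests a t)
forests-unique zero [] = [] AllPairs.∷ AllPairs.[]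
forests-unique (suc a) [] = AllPairs.[]
forests-unique a (t ∷ ts) with a ≤? t
... | no _ = AllPairs.[]
... | yes _ =
  unique-map (map arches) injective
    (unique-concatMap (groupings a) concat (λ R p → proj₁ (All.lookup (groupings-sound a R) p))
       (groupings-unique a) (forests-unique (t ∸ a) ts))
  where
  cuts : List (List Forest)
  cuts = concatMap (groupings a) (forests (t ∸ a) ts)
  dyck-blocks : ∀ {ls} → ls ∈ cuts → All (All IsDyck) ls
  dyck-blocks q with ∈-concatMap-find (groupings a) q
  ... | R , R∈ , ls∈ with All.lookup (groupings-sound a R) ls∈
  ... | refl , _ = All.concat⁻ (proj₁ (forests-sound (t ∸ a) ts R∈))
  injective : ∀ {ls ms} → ls ∈ cuts → ms ∈ cuts → map arches ls ≡ map arches ms → ls ≡ ms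
  injective p q = map-arches-injective (dyck-blocks p) (dyck-blocks q)

forestCount : ℕ → List ℕ → ℕ
forestCount a [] = 1
forestCount a (t ∷ ts) = ((t ∸ 1) C (t ∸ a)) * forestCount (t ∸ a) ts

forests-length : ∀ a t {Fs} → Shaped a t Fs → length (forests a t) ≡ forestCount a t
forests-length a [] sh with shaped-[] sh
... | refl , refl = refl
forests-length a (t ∷ ts) sh with shaped-∷ sh
... | le , ls , _ , _ , inner with a ≤? t
...   | no ¬le = ⊥-elim (¬le le)
...   | yes _ = begin
  length (map (map arches) (concatMap (groupings a) (forests (t ∸ a) ts)))
    ≡⟨ length-map (map arches) (concatMap (groupings a) (forests (t ∸ a) ts)) ⟩
  length (concatMap (groupings a) (forests (t ∸ a) ts))
    ≡⟨ length-concatMap (groupings a) _ (All.tabulate cuttings) ⟩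
  length (forests (t ∸ a) ts) * ((t ∸ 1) C (t ∸ a))
    ≡⟨ *-comm _ ((t ∸ 1) C (t ∸ a)) ⟩
  ((t ∸ 1) C (t ∸ a)) * length (forests (t ∸ a) ts)
    ≡⟨ cong (((t ∸ 1) C (t ∸ a)) *_) (forests-length (t ∸ a) ts inner) ⟩
  ((t ∸ 1) C (t ∸ a)) * forestCount (t ∸ a) ts ∎
  where
  open ≡-Reasoning
  cuttings : ∀ {R} → R ∈ forests (t ∸ a) ts → length (groupings a R) ≡ (t ∸ 1) C (t ∸ a)
  cuttings {R} R∈ = begin
    length (groupings a R)   ≡⟨ groupings-length a R ⟩
    (length R + a ∸ 1) C length R
      ≡⟨ cong (λ n → (n + a ∸ 1) C n) (proj₁ (proj₂ (forests-sound (t ∸ a) ts R∈))) ⟩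
    ((t ∸ a) + a ∸ 1) C (t ∸ a)   ≡⟨ cong (λ m → (m ∸ 1) C (t ∸ a)) (m∸n+n≡m le) ⟩
    (t ∸ 1) C (t ∸ a) ∎

shaped-one : ∀ t {Fs} → Shaped 1 t Fs →
  ∃[ F ] (Fs ≡ [ F ] × IsDyck F × (∀ k → frame F k ≡ entry t k))
shaped-one t {F ∷ []} (dF ∷ [] , refl , e) =
  F , refl , dF , λ k → trans (sym (+-identityʳ (frame F k))) (e k)

one-shaped : ∀ t {F} → IsDyck F → (∀ k → frame F k ≡ entry t k) → Shaped 1 t [ F ]
one-shaped t {F} dF e = dF ∷ [] , refl , λ k → trans (+-identityʳ (frame F k)) (e k)

dyckPaths : List ℕ → List (List Step)
dyckPaths t = map concat (forests 1 t)

dyckPaths-member : ∀ t (p : ℕ → ℕ) → (∀ k → entry t k ≡ p k) →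
  ∀ Q → (Q ∈ dyckPaths t) ⇔ (IsDyck Q × (∀ k → frame Q k ≡ p k))
dyckPaths-member t p profile Q = mk⇔ to from
  where
  to : Q ∈ dyckPaths t → IsDyck Q × (∀ k → frame Q k ≡ p k)
  to q with ∈-map⁻ concat q
  ... | Fs , Fs∈ , refl with shaped-one t (forests-sound 1 t Fs∈)
  ... | F , refl , dF , e rewrite ++-identityʳ F = dF , λ k → trans (e k) (profile k)
  from : IsDyck Q × (∀ k → frame Q k ≡ p k) → Q ∈ dyckPaths t
  from (dQ , e) = subst (_∈ dyckPaths t) (++-identityʳ Q)
    (∈-map⁺ concat (forests-complete 1 t (one-shaped t dQ λ k → trans (e k) (sym (profile k)))))

dyckPaths-unique : ∀ t → Unique (dyckPaths t)
dyckPaths-unique t = unique-map concat injective (forests-unique 1 t)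
  where
  injective : ∀ {Fs Gs} → Fs ∈ forests 1 t → Gs ∈ forests 1 t → concat Fs ≡ concat Gs → Fs ≡ Gs
  injective p q e with shaped-one t (forests-sound 1 t p) | shaped-one t (forests-sound 1 t q)
  ... | F , refl , _ | G , refl , _ = cong [_] (trans (sym (++-identityʳ F)) (trans e (++-identityʳ G)))

dyckPaths-length : ∀ t {Fs} → Shaped 1 t Fs → length (dyckPaths t) ≡ forestCount 1 t
dyckPaths-length t sh = trans (length-map concat (forests 1 t)) (forests-length 1 t sh)

range : ℕ → ℕ → List ℕ
range k zero = []
range k (suc n) = k ∷ range (suc k) n

-- frameCount indexes its factors by applyUpTo suc f = range 1 f.
applyUpTo-range : ∀ (g : ℕ → ℕ) k n → (∀ m → g m ≡ k + m) → applyUpTo g n ≡ range k n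
applyUpTo-range g k zero _ = refl
applyUpTo-range g k (suc n) e =
  cong₂ _∷_ (trans (e 0) (+-identityʳ k))
            (applyUpTo-range (λ m → g (suc m)) (suc k) n (λ m → trans (e (suc m)) (+-suc k m)))

entry-window : ∀ (p : ℕ → ℕ) m n → (∀ k → n ≤ k → p (m + k) ≡ 0) →
  ∀ k → entry (map p (range m n)) k ≡ p (m + k)
entry-window p m zero vanish k = sym (vanish k z≤n)
entry-window p m (suc n) vanish zero = cong p (sym (+-identityʳ m))
entry-window p m (suc n) vanish (suc k) =
  trans (entry-window p (suc m) n vanish′ k) (cong p (sym (+-suc m k)))
  where
  vanish′ : ∀ k → n ≤ k → p (suc m + k) ≡ 0
  vanish′ k n≤k = trans (cong p (sym (+-suc m k))) (vanish (suc k) (s≤s n≤k))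

open AlternatingSums using (Roots; roots-zero; jSeq-roots-step; frameFactor; frameFactor-roots)

forestCount-frameFactors : ∀ (i : ℕ → ℕ) k n a {Fs} → Roots i k a → Shaped a (map i (range k n)) Fs →
  forestCount a (map i (range k n)) ≡ product (map (frameFactor i) (range k n))
forestCount-frameFactors i k zero a roots sh = refl
forestCount-frameFactors i k (suc n) a roots sh with shaped-∷ sh
... | a≤ik , _ , _ , _ , inner =
  cong₂ _*_ (sym (frameFactor-roots i k a roots a≤ik))
            (forestCount-frameFactors i (suc k) n (i k ∸ a) (jSeq-roots-step i k a roots a≤ik) inner)

-- A Dyck path has a single tree; its level-0 factor is C(i₀ − 1, i₀ − 1) = 1.
forestCount-frameCount : ∀ (i : ℕ → ℕ) f {Fs} → Shaped 1 (map i (range 0 (suc f))) Fs →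
  forestCount 1 (map i (range 0 (suc f))) ≡ frameCount i f
forestCount-frameCount i f sh = begin
  forestCount 1 (map i (range 0 (suc f)))
    ≡⟨ forestCount-frameFactors i 0 (suc f) 1 (roots-zero i) sh ⟩
  frameFactor i 0 * product (map (frameFactor i) (range 1 f))
    ≡⟨ cong₂ _*_ ground (cong (λ ks → product (map (frameFactor i) ks))
                               (sym (applyUpTo-range suc 1 f (λ _ → refl)))) ⟩
  1 * frameCount i f
    ≡⟨ *-identityˡ (frameCount i f) ⟩
  frameCount i f ∎
  where
  open ≡-Reasoning
  ground : frameFactor i 0 ≡ 1
  ground = trans (frameFactor-roots i 0 1 (roots-zero i) (proj₁ (shaped-∷ sh))) (nCn≡1 (i 0 ∸ 1))

mainTheorem15 : (P : List Step) → IsDyck P →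
    (f : ℕ) → frame P f ≢ 0 → (∀ k → f < k → frame P k ≡ 0) →
    Σ (List (List Step)) λ L →
    Unique L ×
    (∀ Q → (Q ∈ L) ⇔ (IsDyck Q × (∀ k → frame Q k ≡ frame P k))) ×
    length L ≡ frameCount (frame P) f
-- The paths are dyckPaths of the frame of P listed up to level f (beyond which
-- it vanishes); P itself witnesses that this profile is realisable.
mainTheorem15 P dP f _ vanish =
  dyckPaths t , dyckPaths-unique t , dyckPaths-member t i profile ,
  trans (dyckPaths-length t shapedP) (forestCount-frameCount i f shapedP)
  where
  i : ℕ → ℕ
  i = frame P
  t : List ℕ
  t = map i (range 0 (suc f))
  profile : ∀ k → entry t k ≡ i k
  profile = entry-window i 0 (suc f) vanish
  shapedP : Shaped 1 t [ P ]
  shapedP = one-shaped t dP (λ k → sym (profile k))
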